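{- Let $M$ be a matroid of finite rank $m$ with closure operator $\mathrm{cl}$, and let $r\ge 1$ be an integer. Then there exists a sequence $S$ of non-loops of $M$ with $|S|=m(r-1)$ such that for every choice of $r$ pairwise disjoint subsequences $S_1,\ldots,S_r$ of $S$ one has \[ \bigcap_{i=1}^r \mathrm{cl}\, S_i=\mathrm{cl}\,\emptyset . \]
   Context: A sequence $S=(m_i)_{i\in I}$ of elements of $M$ is identified with the set of pairs $\{(i,m_i): i\in I\}$; subsequences are subsets of these pairs and two subsequences are disjoint if they share no pair. For a sequence $T$, $\mathrm{cl}\,T$ means the closure of the set of elements appearing in $T$. A non-loop is an element $x$ with $x\notin\mathrm{cl}\,\emptyset$. -}

module Defs where

open import Data.Nat using (ℕ; zero; suc; _+_; _≤_)
open import Data.Bool using (true; false)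
open import Data.List using (List; []; _∷_)
open import Data.List.Relation.Binary.Subset.Propositional using (_⊆_)
open import Data.Vec using (Vec; []; _∷_)
open import Data.Fin.Subset using (Subset)
open import Data.Sum using (_⊎_)
open import Relation.Binary.PropositionalEquality using (_≡_)
open import Data.Product using (_×_; Σ)
open import Data.Empty using (⊥)

-- A matroid on an arbitrary (possibly infinite) ground type E, given by its
-- rank function on finite subsets.  A finite subset is represented by a list
-- (duplicates and order are irrelevant: by monotonicity, lists with the same
-- underlying set have the same rank).
record Matroid (E : Set) : Set₁ where
  field
    rk        : List E → ℕ
    rk-empty  : rk [] ≡ 0
    rk-mono   : ∀ {X Y} → X ⊆ Y → rk X ≤ rk Y
    rk-unit   : ∀ x X → (rk (x ∷ X) ≡ rk X) ⊎ (rk (x ∷ X) ≡ suc (rk X))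
    rk-submod : ∀ x y X → rk (x ∷ X) ≡ rk X → rk (y ∷ X) ≡ rk X →
                rk (x ∷ y ∷ X) ≡ rk X

  _∈cl_ : E → List E → Set
  x ∈cl X = rk (x ∷ X) ≡ rk X

  NonLoop : E → Set
  NonLoop x = x ∈cl [] → ⊥

HasRank : {E : Set} → Matroid E → ℕ → Set
HasRank {E} M m = (∀ X → rk X ≤ m) × Σ (List E) (λ X → rk X ≡ m)
  where open Matroid M

subseq : {E : Set} {n : ℕ} → Vec E n → Subset n → List E
subseq []       []          = []
subseq (x ∷ xs) (true ∷ a)  = x ∷ subseq xs a
subseq (x ∷ xs) (false ∷ a) = subseq xs a

-- Repeat each element of a basis b₁ … b_m of M exactly r − 1 times.  A subsequence
-- S_i spans the same flat as the set B_i of basis elements it meets, and r pairwise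
-- disjoint subsequences cannot all meet the r − 1 copies of one b_j (pigeonhole),
-- so ⋂ B_i = ∅.  For subsets of an independent set closures intersect like the sets
-- themselves, cl B ∩ cl B′ = cl (B ∩ B′): an element of B ∖ B′ can be dropped from B
-- by the exchange property, since otherwise it would lie in the closure of the rest
-- of the basis.  Hence ⋂ cl S_i ⊆ ⋂ cl B_i = cl (⋂ B_i) = cl ∅.
module Submission where

open import Defs
open import Data.Nat using (ℕ; zero; suc; _*_; _∸_; _≤_; _≟_; s≤s)
open import Data.Nat.Properties using (1+n≢n; ≤-antisym; ≤-trans; ≤-reflexive; n≤1+n; ≤-pred; <-irrefl; n<1+n)
open import Data.Bool using (true; false)
open import Data.Fin using (Fin; zero; suc; combine)
open import Data.Fin.Properties using (any?; pigeonhole; <⇒≢; combine-remQuot)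
open import Data.Fin.Subset using (Subset; _∈_; _∩_; Empty)
open import Data.Fin.Subset.Properties using (_∈?_; x∈p∩q⁻)
open import Data.Vec using (Vec; here; there; []; _∷_; toList; lookup; replicate; concat; map; tabulate)
open import Data.Vec.Properties using (lookup-concat; lookup-map; lookup-replicate; lookup∘tabulate; []=⇒lookup; lookup⇒[]=)
open import Data.Vec.Membership.Propositional.Properties using (∈-lookup; ∈-toList⁺)
open import Data.Vec.Relation.Unary.All using (All; []; _∷_)
import Data.Vec.Relation.Unary.All as All
open import Data.Vec.Relation.Unary.All.Properties using (concat⁺; map⁺)
open import Data.List using (List; []; _∷_; _++_; length)
open import Data.List.Properties using (++-identityʳ)
open import Data.List.Relation.Unary.Any using (here; there)
open import Data.List.Membership.Propositional renaming (_∈_ to _∈ₗ_)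
open import Data.List.Membership.Propositional.Properties using (∈-++⁻)
open import Data.List.Relation.Binary.Subset.Propositional using (_⊆_)
open import Data.List.Relation.Binary.Subset.Propositional.Properties using (⊆-reflexive-↭; xs⊆x∷xs; ∷⁺ʳ; ++⁺ˡ; xs⊆xs++ys; xs⊆ys++xs)
open import Data.List.Relation.Binary.Permutation.Propositional using (_↭_; ↭-sym; ↭-reflexive; swap; refl)
open import Data.List.Relation.Binary.Permutation.Propositional.Properties using (shift; ↭-length)
open import Data.Sum using (inj₁; inj₂; [_,_]′)
open import Data.Product using (Σ; ∃; _×_; _,_; proj₁; proj₂)
open import Function using (_∘_; id)
open import Relation.Nullary using (¬_; Dec; yes; no; does; contradiction)
open import Relation.Nullary.Decidable using (dec-true)
open import Relation.Binary.PropositionalEquality using (_≡_; refl; sym; trans; cong; subst; module ≡-Reasoning)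
import Data.Nat.Properties as ℕ

⋂ᶠ : ∀ {r n} → (Fin (suc r) → Subset n) → Subset n
⋂ᶠ {zero}  F = F zero
⋂ᶠ {suc r} F = F zero ∩ ⋂ᶠ (F ∘ suc)

∈-⋂ᶠ⁻ : ∀ {r n} (F : Fin (suc r) → Subset n) {j} → j ∈ ⋂ᶠ F → ∀ i → j ∈ F i
∈-⋂ᶠ⁻ {zero}  F j∈ zero    = j∈
∈-⋂ᶠ⁻ {suc r} F j∈ zero    = proj₁ (x∈p∩q⁻ (F zero) _ j∈)
∈-⋂ᶠ⁻ {suc r} F j∈ (suc i) = ∈-⋂ᶠ⁻ (F ∘ suc) (proj₂ (x∈p∩q⁻ (F zero) _ j∈)) i

PairwiseDisjoint : ∀ {r n} → (Fin r → Subset n) → Set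
PairwiseDisjoint A = ∀ i j → ¬ (i ≡ j) → ∀ k → k ∈ A i → ¬ (k ∈ A j)

disjoint-pigeonhole : ∀ {k n} (A : Fin (suc k) → Subset n) → PairwiseDisjoint A →
  (f : Fin k → Fin n) → ¬ (∀ i → ∃ λ t → f t ∈ A i)
disjoint-pigeonhole {k} A disjoint f meets with pigeonhole (n<1+n k) (proj₁ ∘ meets)
... | i , i′ , i<i′ , same = disjoint i i′ (<⇒≢ i<i′) _ (proj₂ (meets i))
  (subst (λ t → f t ∈ A i′) (sym same) (proj₂ (meets i′)))

-- Positions in Fin (m * k) are read as pairs (block j, copy i) via combine j i;
-- blocksMet k p is the set of blocks that p meets.
blocksMet : ∀ {m} k → Subset (m * k) → Subset m
blocksMet k p = tabulate λ j → does (any? λ i → combine j i ∈? p)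

∈-blocksMet⁺ : ∀ {m k} {p : Subset (m * k)} {j : Fin m} {i : Fin k} →
  combine j i ∈ p → j ∈ blocksMet k p
∈-blocksMet⁺ {p = p} {j} {i} ji∈p =
  lookup⇒[]= j (blocksMet _ p)
    (trans (lookup∘tabulate (λ j → does (any? λ t → combine j t ∈? p)) j)
           (dec-true (any? λ t → combine j t ∈? p) (i , ji∈p)))

∈-blocksMet⁻ : ∀ {m k} {p : Subset (m * k)} {j : Fin m} →
  j ∈ blocksMet k p → ∃ λ i → combine j i ∈ p
∈-blocksMet⁻ {p = p} {j} j∈
  with any? (λ i → combine j i ∈? p)
     | trans (sym (lookup∘tabulate (λ j → does (any? λ i → combine j i ∈? p)) j)) ([]=⇒lookup j∈)
... | yes meets | _ = meets
... | no  _     | ()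

⋂ᶠ-blocksMet-Empty : ∀ {m k} (A : Fin (suc k) → Subset (m * k)) → PairwiseDisjoint A →
  Empty (⋂ᶠ (blocksMet {m} k ∘ A))
⋂ᶠ-blocksMet-Empty {m} {k} A disjoint (j , j∈⋂) =
  disjoint-pigeonhole A disjoint (combine j) (λ i → ∈-blocksMet⁻ (∈-⋂ᶠ⁻ (blocksMet {m} k ∘ A) j∈⋂ i))

module _ {A : Set} where

  ∈-subseq⁺ : ∀ {n} (S : Vec A n) {p : Subset n} {j : Fin n} → j ∈ p → lookup S j ∈ₗ subseq S p
  ∈-subseq⁺ (x ∷ S) here                     = here refl
  ∈-subseq⁺ (x ∷ S) {true ∷ p}  (there j∈p) = there (∈-subseq⁺ S j∈p)
  ∈-subseq⁺ (x ∷ S) {false ∷ p} (there j∈p) = ∈-subseq⁺ S j∈p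

  ∈-subseq⁻ : ∀ {n} (S : Vec A n) (p : Subset n) {z : A} →
              z ∈ₗ subseq S p → ∃ λ j → j ∈ p × lookup S j ≡ z
  ∈-subseq⁻ []      []          ()
  ∈-subseq⁻ (x ∷ S) (true ∷ p)  (here refl) = zero , here , refl
  ∈-subseq⁻ (x ∷ S) (true ∷ p)  (there z∈) with ∈-subseq⁻ S p z∈
  ... | j , j∈p , eq = suc j , there j∈p , eq
  ∈-subseq⁻ (x ∷ S) (false ∷ p) z∈ with ∈-subseq⁻ S p z∈
  ... | j , j∈p , eq = suc j , there j∈p , eq

  subseq-⊆ : ∀ {n} (S : Vec A n) (p : Subset n) → subseq S p ⊆ toList S
  subseq-⊆ S p z∈ with ∈-subseq⁻ S p z∈
  ... | j , _ , refl = ∈-toList⁺ (∈-lookup j S)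

  Empty⇒subseq⊆[] : ∀ {n} (S : Vec A n) {p : Subset n} → Empty p → subseq S p ⊆ []
  Empty⇒subseq⊆[] S {p} p-empty z∈ with ∈-subseq⁻ S p z∈
  ... | j , j∈p , _ = contradiction (j , j∈p) p-empty

  stretch : ∀ {m} → Vec A m → (k : ℕ) → Vec A (m * k)
  stretch bs k = concat (map (replicate k) bs)

  lookup-stretch : ∀ {m k} (bs : Vec A m) j (i : Fin k) →
                   lookup (stretch bs k) (combine j i) ≡ lookup bs j
  lookup-stretch {k = k} bs j i = begin
    lookup (concat (map (replicate k) bs)) (combine j i) ≡⟨ lookup-concat (map (replicate k) bs) j i ⟩
    lookup (lookup (map (replicate k) bs) j) i           ≡⟨ cong (λ v → lookup v i) (lookup-map j (replicate k) bs) ⟩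
    lookup (replicate k (lookup bs j)) i                 ≡⟨ lookup-replicate i (lookup bs j) ⟩
    lookup bs j                                          ∎
    where open ≡-Reasoning

  All-stretch : ∀ {P : A → Set} {m} {bs : Vec A m} k → All P bs → All P (stretch bs k)
  All-stretch k Pbs = concat⁺ (map⁺ (All.map replicate⁺ Pbs))
    where
      replicate⁺ : ∀ {P : A → Set} {x} {k} → P x → All P (replicate k x)
      replicate⁺ {k = zero}  Px = []
      replicate⁺ {k = suc k} Px = Px ∷ replicate⁺ Px

  subseq-stretch-⊆ : ∀ {m} (bs : Vec A m) k p → subseq (stretch bs k) p ⊆ subseq bs (blocksMet k p)
  subseq-stretch-⊆ {m} bs k p z∈ with ∈-subseq⁻ (stretch bs k) p z∈
  ... | q , q∈p , refl = subst (λ t → lookup (stretch bs k) t ∈ₗ subseq bs (blocksMet k p))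
    (combine-remQuot {m} k q) (hit (subst (_∈ p) (sym (combine-remQuot {m} k q)) q∈p))
    where
      hit : ∀ {j i} → combine j i ∈ p → lookup (stretch bs k) (combine j i) ∈ₗ subseq bs (blocksMet k p)
      hit {j} {i} ji∈p = subst (_∈ₗ subseq bs (blocksMet k p)) (sym (lookup-stretch bs j i))
                               (∈-subseq⁺ bs (∈-blocksMet⁺ ji∈p))

module _ {E : Set} (M : Matroid E) where
  open Matroid M

  rk-cong : ∀ {X Y} → X ⊆ Y → Y ⊆ X → rk X ≡ rk Y
  rk-cong X⊆Y Y⊆X = ≤-antisym (rk-mono X⊆Y) (rk-mono Y⊆X)

  ∈cl-cong : ∀ {x X Y} → X ⊆ Y → Y ⊆ X → x ∈cl X → x ∈cl Y
  ∈cl-cong {x} X⊆Y Y⊆X x∈clX =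
    trans (rk-cong (∷⁺ʳ x Y⊆X) (∷⁺ʳ x X⊆Y)) (trans x∈clX (rk-cong X⊆Y Y⊆X))

  rk-resp-↭ : ∀ {X Y} → X ↭ Y → rk X ≡ rk Y
  rk-resp-↭ X↭Y = rk-cong (⊆-reflexive-↭ X↭Y) (⊆-reflexive-↭ (↭-sym X↭Y))

  ∈cl-resp-↭ : ∀ {x X Y} → X ↭ Y → x ∈cl X → x ∈cl Y
  ∈cl-resp-↭ X↭Y = ∈cl-cong (⊆-reflexive-↭ X↭Y) (⊆-reflexive-↭ (↭-sym X↭Y))

  _∈cl?_ : ∀ x X → Dec (x ∈cl X)
  x ∈cl? X = rk (x ∷ X) ≟ rk X

  rk-∷-≤ : ∀ y X → rk (y ∷ X) ≤ suc (rk X)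
  rk-∷-≤ y X = [ (λ e → ≤-trans (≤-reflexive e) (n≤1+n _)) , ≤-reflexive ]′ (rk-unit y X)

  ∈cl-∷ : ∀ {x X} y → x ∈cl X → x ∈cl (y ∷ X)
  ∈cl-∷ {x} {X} y x∈clX with rk-unit y X
  ... | inj₁ y∈clX = trans (rk-submod x y X x∈clX y∈clX) (sym y∈clX)
  ... | inj₂ rk+1  = ≤-antisym
    (begin
      rk (x ∷ y ∷ X)   ≡⟨ rk-resp-↭ (swap x y refl) ⟩
      rk (y ∷ x ∷ X)   ≤⟨ rk-∷-≤ y (x ∷ X) ⟩
      suc (rk (x ∷ X)) ≡⟨ cong suc x∈clX ⟩
      suc (rk X)       ≡⟨ sym rk+1 ⟩
      rk (y ∷ X)       ∎)
    (rk-mono (xs⊆x∷xs _ x))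
    where open ℕ.≤-Reasoning

  ∈cl-++ : ∀ {x X} Y → x ∈cl X → x ∈cl (Y ++ X)
  ∈cl-++ []      x∈clX = x∈clX
  ∈cl-++ (y ∷ Y) x∈clX = ∈cl-∷ y (∈cl-++ Y x∈clX)

  ∈cl-mono : ∀ {x X Y} → X ⊆ Y → x ∈cl X → x ∈cl Y
  ∈cl-mono {X = X} {Y} X⊆Y x∈clX =
    ∈cl-cong ([ id , X⊆Y ]′ ∘ ∈-++⁻ Y) (xs⊆xs++ys Y X) (∈cl-++ Y x∈clX)

  ∈cl-cut : ∀ {x b Y} → b ∈cl Y → x ∈cl (b ∷ Y) → x ∈cl Y
  ∈cl-cut {x} {b} {Y} b∈clY x∈clbY = ≤-antisym
    (begin
      rk (x ∷ Y)     ≤⟨ rk-mono (∷⁺ʳ x (xs⊆x∷xs Y b)) ⟩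
      rk (x ∷ b ∷ Y) ≡⟨ x∈clbY ⟩
      rk (b ∷ Y)     ≡⟨ b∈clY ⟩
      rk Y           ∎)
    (rk-mono (xs⊆x∷xs Y x))
    where open ℕ.≤-Reasoning

  ∈cl-exchange : ∀ {x b Y} → ¬ x ∈cl Y → x ∈cl (b ∷ Y) → b ∈cl (x ∷ Y)
  ∈cl-exchange {x} {b} {Y} x∉clY x∈clbY with rk-unit b Y | rk-unit x Y
  ... | inj₁ b∈clY | _          = contradiction (∈cl-cut b∈clY x∈clbY) x∉clY
  ... | _          | inj₁ x∈clY = contradiction x∈clY x∉clY
  ... | inj₂ rk+1ᵇ | inj₂ rk+1ˣ = begin
    rk (b ∷ x ∷ Y) ≡⟨ rk-resp-↭ (swap b x refl) ⟩
    rk (x ∷ b ∷ Y) ≡⟨ x∈clbY ⟩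
    rk (b ∷ Y)     ≡⟨ trans rk+1ᵇ (sym rk+1ˣ) ⟩
    rk (x ∷ Y)     ∎
    where open ≡-Reasoning

  ∈cl-drop : ∀ {x b L Y Z} → ¬ b ∈cl L → Y ⊆ L → Z ⊆ L →
             x ∈cl (b ∷ Y) → x ∈cl Z → x ∈cl Y
  ∈cl-drop {x} {b} {L} {Y} {Z} b∉clL Y⊆L Z⊆L x∈clbY x∈clZ with x ∈cl? Y
  ... | yes x∈clY = x∈clY
  ... | no  x∉clY = contradiction (∈cl-mono Z++Y⊆L b∈clZ++Y) b∉clL
    where
      Z++Y⊆L : Z ++ Y ⊆ L
      Z++Y⊆L = [ Z⊆L , Y⊆L ]′ ∘ ∈-++⁻ Z
      b∈clZ++Y : b ∈cl (Z ++ Y)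
      b∈clZ++Y = ∈cl-cut (∈cl-mono (xs⊆xs++ys Z Y) x∈clZ)
                         (∈cl-mono (∷⁺ʳ x (xs⊆ys++xs Y Z)) (∈cl-exchange x∉clY x∈clbY))

  Independent : List E → Set
  Independent X = rk X ≡ length X

  rk≤length : ∀ X → rk X ≤ length X
  rk≤length []      = ≤-reflexive rk-empty
  rk≤length (x ∷ X) = ≤-trans (rk-∷-≤ x X) (s≤s (rk≤length X))

  Independent-∷⁻ : ∀ {b X} → Independent (b ∷ X) → Independent X
  Independent-∷⁻ {b} {X} ind =
    ≤-antisym (rk≤length X) (≤-pred (≤-trans (≤-reflexive (sym ind)) (rk-∷-≤ b X)))

  Independent⇒∉cl : ∀ {b X} → Independent (b ∷ X) → ¬ b ∈cl X
  Independent⇒∉cl {b} {X} ind b∈clX =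
    <-irrefl refl (≤-trans (≤-reflexive (sym ind)) (≤-trans (≤-reflexive b∈clX) (rk≤length X)))

  Independent-∷⁺ : ∀ {b X} → ¬ b ∈cl X → Independent X → Independent (b ∷ X)
  Independent-∷⁺ {b} {X} b∉clX ind with rk-unit b X
  ... | inj₁ b∈clX = contradiction b∈clX b∉clX
  ... | inj₂ rk+1  = trans rk+1 (cong suc ind)

  Independent-resp-↭ : ∀ {X Y} → X ↭ Y → Independent X → Independent Y
  Independent-resp-↭ X↭Y ind = trans (sym (rk-resp-↭ X↭Y)) (trans ind (↭-length X↭Y))

  Independent⇒All-NonLoop : ∀ {n} (bs : Vec E n) → Independent (toList bs) → All NonLoop bs
  Independent⇒All-NonLoop []       _   = []
  Independent⇒All-NonLoop (b ∷ bs) ind =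
    (λ b∈cl[] → Independent⇒∉cl ind (∈cl-mono (λ ()) b∈cl[]))
    ∷ Independent⇒All-NonLoop bs (Independent-∷⁻ ind)

  basis : ∀ X → Σ (Vec E (rk X)) λ bs → Independent (toList bs) × toList bs ⊆ X
  basis [] rewrite rk-empty = [] , rk-empty , λ ()
  basis (x ∷ X) with basis X | rk-unit x X
  ... | bs , ind , bs⊆X | inj₁ x∈clX rewrite x∈clX = bs , ind , there ∘ bs⊆X
  ... | bs , ind , bs⊆X | inj₂ rk+1  rewrite rk+1  =
    x ∷ bs , Independent-∷⁺ x∉clbs ind , ∷⁺ʳ x bs⊆X
    where
      x∉clbs : ¬ x ∈cl toList bs
      x∉clbs x∈clbs = 1+n≢n (trans (sym rk+1) (∈cl-mono bs⊆X x∈clbs))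

  -- Elements in only one of p, q are dropped by ∈cl-drop; common ones are moved into C.
  ∈cl-subseq-∩-++ : ∀ {n x} (bs : Vec E n) (C : List E) → Independent (toList bs ++ C) →
    ∀ p q → x ∈cl (subseq bs p ++ C) → x ∈cl (subseq bs q ++ C) → x ∈cl (subseq bs (p ∩ q) ++ C)
  ∈cl-subseq-∩-++ []       C ind []          []          h₁ h₂ = h₁
  ∈cl-subseq-∩-++ (b ∷ bs) C ind (true ∷ p)  (true ∷ q)  h₁ h₂ =
    ∈cl-resp-↭ (shift b (subseq bs (p ∩ q)) C)
      (∈cl-subseq-∩-++ bs (b ∷ C) (Independent-resp-↭ (↭-sym (shift b (toList bs) C)) ind) p q
        (∈cl-resp-↭ (↭-sym (shift b (subseq bs p) C)) h₁)
        (∈cl-resp-↭ (↭-sym (shift b (subseq bs q) C)) h₂))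
  ∈cl-subseq-∩-++ (b ∷ bs) C ind (true ∷ p)  (false ∷ q) h₁ h₂ =
    ∈cl-subseq-∩-++ bs C (Independent-∷⁻ ind) p q
      (∈cl-drop (Independent⇒∉cl ind) (++⁺ˡ C (subseq-⊆ bs p)) (++⁺ˡ C (subseq-⊆ bs q)) h₁ h₂) h₂
  ∈cl-subseq-∩-++ (b ∷ bs) C ind (false ∷ p) (true ∷ q)  h₁ h₂ =
    ∈cl-subseq-∩-++ bs C (Independent-∷⁻ ind) p q
      h₁ (∈cl-drop (Independent⇒∉cl ind) (++⁺ˡ C (subseq-⊆ bs q)) (++⁺ˡ C (subseq-⊆ bs p)) h₂ h₁)
  ∈cl-subseq-∩-++ (b ∷ bs) C ind (false ∷ p) (false ∷ q) h₁ h₂ =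
    ∈cl-subseq-∩-++ bs C (Independent-∷⁻ ind) p q h₁ h₂

  ∈cl-subseq-∩ : ∀ {n x} (bs : Vec E n) → Independent (toList bs) →
    ∀ p q → x ∈cl subseq bs p → x ∈cl subseq bs q → x ∈cl subseq bs (p ∩ q)
  ∈cl-subseq-∩ bs ind p q h₁ h₂ =
    ∈cl-resp-↭ (++-[] (subseq bs (p ∩ q)))
      (∈cl-subseq-∩-++ bs [] (Independent-resp-↭ (↭-sym (++-[] (toList bs))) ind) p q
        (∈cl-resp-↭ (↭-sym (++-[] (subseq bs p))) h₁)
        (∈cl-resp-↭ (↭-sym (++-[] (subseq bs q))) h₂))
    where
      ++-[] : ∀ X → X ++ [] ↭ X
      ++-[] X = ↭-reflexive (++-identityʳ X)

  ∈cl-subseq-⋂ᶠ : ∀ {r n x} (bs : Vec E n) → Independent (toList bs) →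
    (F : Fin (suc r) → Subset n) → (∀ i → x ∈cl subseq bs (F i)) → x ∈cl subseq bs (⋂ᶠ F)
  ∈cl-subseq-⋂ᶠ {zero}  bs ind F h = h zero
  ∈cl-subseq-⋂ᶠ {suc r} bs ind F h =
    ∈cl-subseq-∩ bs ind (F zero) (⋂ᶠ (F ∘ suc)) (h zero) (∈cl-subseq-⋂ᶠ bs ind (F ∘ suc) (h ∘ suc))

  ∈cl-disjoint-subseqs-stretch⇒∈cl[] : ∀ {n k x} (bs : Vec E n) → Independent (toList bs) →
    (A : Fin (suc k) → Subset (n * k)) → PairwiseDisjoint A →
    (∀ i → x ∈cl subseq (stretch bs k) (A i)) → x ∈cl []
  ∈cl-disjoint-subseqs-stretch⇒∈cl[] {k = k} bs ind A disjoint x∈cl =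
    ∈cl-mono (Empty⇒subseq⊆[] bs (⋂ᶠ-blocksMet-Empty A disjoint))
      (∈cl-subseq-⋂ᶠ bs ind (blocksMet k ∘ A)
        (λ i → ∈cl-mono (subseq-stretch-⊆ bs k (A i)) (x∈cl i)))

proposition1 : {E : Set} (M : Matroid E) (m : ℕ) → HasRank M m →
    (r : ℕ) → 1 ≤ r →
    Σ (Vec E (m * (r ∸ 1))) λ S →
      All (Matroid.NonLoop M) S ×
      ((A : Fin r → Subset (m * (r ∸ 1))) →
        (∀ i j → ¬ (i ≡ j) → ∀ k → k ∈ A i → ¬ (k ∈ A j)) →
        ∀ x → (((∀ i → Matroid._∈cl_ M x (subseq S (A i))) → Matroid._∈cl_ M x [])
              × (Matroid._∈cl_ M x [] → ∀ i → Matroid._∈cl_ M x (subseq S (A i)))))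
proposition1 M m (_ , X , rkX≡m) (suc k) _ with Matroid.rk M X | basis M X | rkX≡m
... | .m | bs , ind , _ | refl =
  stretch bs k ,
  All-stretch k (Independent⇒All-NonLoop M bs ind) ,
  λ A disjoint x →
    ∈cl-disjoint-subseqs-stretch⇒∈cl[] M bs ind A disjoint ,
    λ x∈cl[] i → ∈cl-mono M (λ ()) x∈cl[]
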